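{- Let $(\psi,\varphi)$ be a specification where $\varphi=\forall\pi_1\ldots\forall\pi_n\exists\pi_{n+1}\ldots\exists\pi_{n+m}\mathpunct{.}\phi$, and where $\psi$ and $\phi$ (the latter read as an LTL formula over $\mathit{AP}_{\pi_1}\cup\cdots\cup\mathit{AP}_{\pi_{n+m}}$) are arbitrary but satisfiable LTL formulas. Then there is an effectively computable specification $(\psi',\varphi')$ such that $\psi'$ is an LTL formula describing a liveness property, $\varphi'$ is a HyperLTL formula with quantifier prefix $\forall^n\exists^m$ that is temporal liveness, and $(\psi,\varphi)$ is satisfiable iff $(\psi',\varphi')$ is satisfiable.
   Context: Fix a finite set $\mathit{AP}$ of atomic propositions and $\Sigma=2^{\mathit{AP}}$; traces are elements of $\Sigma^\omega$. LTL: $\psi ::= a \mid \neg\psi \mid \psi\wedge\psi \mid \mathsf{X}\psi \mid \psi\,\mathsf{U}\,\psi$ with standard semantics. HyperLTL: $\varphi ::= \exists\pi\mathpunct{.}\varphi \mid \forall\pi\mathpunct{.}\varphi \mid \phi$, $\phi ::= a_\pi \mid \neg\phi\mid\phi\wedge\phi\mid\mathsf{X}\phi\mid\phi\,\mathsf{U}\,\phi$ (closed); semantics w.r.t. a set of traces $T$ with quantifiers ranging over $T$ and temporal operators shifting all bound traces synchronously. $\mathit{AP}_\pi=\{a_\pi\mid a\in\mathit{AP}\}$. A specification $(\psi,\varphi)$ is satisfiable iff there is a non-empty $T\subseteq\Sigma^\omega$ with every $t\in T$ satisfying $\psi$ and $T\models\varphi$. A trace property $P$ is liveness if every finite word is a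 prefix of some trace in $P$. A HyperLTL formula $Q_1\pi_1\ldots Q_k\pi_k\mathpunct{.}\phi$ is temporal liveness if $\phi$, read as an LTL formula over $\mathit{AP}_{\pi_1}\cup\cdots\cup\mathit{AP}_{\pi_k}$, describes a liveness property. (The new formulas may use fresh atomic propositions.) -}

module Defs where

open import Data.Nat using (ℕ; zero; suc; _≤_; _<_)
open import Data.Bool using (Bool; true)
open import Data.Fin using (Fin)
open import Data.Vec using (Vec; []; _∷ʳ_; lookup)
open import Data.List using (List; []; _∷_)
open import Data.Product using (Σ; _×_; _,_; proj₁; proj₂)
open import Data.Unit using (⊤)
open import Data.Empty using (⊥)
open import Relation.Nullary using (¬_)
open import Relation.Binary.PropositionalEquality using (_≡_)

Letter : Set → Set
Letter A = A → Bool

Trace : Set → Set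
Trace A = ℕ → Letter A

Word : Set → Set
Word A = List (Letter A)

data LTL (A : Set) : Set where
  atom : A → LTL A
  ¬'   : LTL A → LTL A
  _∧'_ : LTL A → LTL A → LTL A
  X'   : LTL A → LTL A
  _U'_ : LTL A → LTL A → LTL A

_at_⊨_ : {A : Set} → Trace A → ℕ → LTL A → Set
t at i ⊨ atom a   = t i a ≡ true
t at i ⊨ ¬' ψ     = ¬ (t at i ⊨ ψ)
t at i ⊨ (ψ ∧' χ) = (t at i ⊨ ψ) × (t at i ⊨ χ)
t at i ⊨ X' ψ     = t at suc i ⊨ ψ
t at i ⊨ (ψ U' χ) = Σ ℕ λ j → (i ≤ j) × (t at j ⊨ χ) × (∀ k → i ≤ k → k < j → t at k ⊨ ψ)

_⊨_ : {A : Set} → Trace A → LTL A → Set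
t ⊨ ψ = t at 0 ⊨ ψ

LTLSat : {A : Set} → LTL A → Set
LTLSat ψ = Σ (Trace _) λ t → t ⊨ ψ

IsPrefix : {A : Set} → Word A → Trace A → Set
IsPrefix []      t = ⊤
IsPrefix (x ∷ w) t = (∀ a → x a ≡ t 0 a) × IsPrefix w (λ i → t (suc i))

Liveness : {A : Set} → LTL A → Set
Liveness {A} ψ = ∀ (w : Word A) → Σ (Trace A) λ t → IsPrefix w t × t ⊨ ψ

-- HyperLTL formulas with v trace variables in scope; the variables are π_1..π_v,
-- indexed by Fin v (index 0 = outermost quantifier). AP_π is represented by Fin v × A.
data Hyper (A : Set) : ℕ → Set where
  ∀' : {v : ℕ} → Hyper A (suc v) → Hyper A v
  ∃' : {v : ℕ} → Hyper A (suc v) → Hyper A v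
  body : {v : ℕ} → LTL (Fin v × A) → Hyper A v

zipT : {A : Set} {v : ℕ} → Vec (Trace A) v → Trace (Fin v × A)
zipT env i (j , a) = lookup env j i a

HSat : {A : Set} {v : ℕ} → (Trace A → Set) → Vec (Trace A) v → Hyper A v → Set
HSat T env (∀' φ)   = ∀ t → T t → HSat T (env ∷ʳ t) φ
HSat T env (∃' φ)   = Σ (Trace _) λ t → T t × HSat T (env ∷ʳ t) φ
HSat T env (body φ) = zipT env ⊨ φ

_⊨H_ : {A : Set} → (Trace A → Set) → Hyper A 0 → Set
T ⊨H φ = HSat T [] φ

ExPrefix : {A : Set} {v : ℕ} → ℕ → Hyper A v → Set
ExPrefix zero    (body _) = ⊤
ExPrefix (suc m) (∃' φ)   = ExPrefix m φ
ExPrefix _       _        = ⊥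

AEPrefix : {A : Set} {v : ℕ} → ℕ → ℕ → Hyper A v → Set
AEPrefix zero    m φ      = ExPrefix m φ
AEPrefix (suc n) m (∀' φ) = AEPrefix n m φ
AEPrefix (suc n) m _      = ⊥

matrix : {A : Set} {v : ℕ} → Hyper A v → Σ ℕ λ w → LTL (Fin w × A)
matrix (∀' φ)       = matrix φ
matrix (∃' φ)       = matrix φ
matrix {v = v} (body φ) = v , φ

TemporalLiveness : {A : Set} {v : ℕ} → Hyper A v → Set
TemporalLiveness φ = Liveness (proj₂ (matrix φ))

SpecSat : {A : Set} → LTL A → Hyper A 0 → Set₁
SpecSat {A} ψ φ = Σ (Trace A → Set) λ T →
  (Σ (Trace A) T) × (∀ t → T t → t ⊨ ψ) × (T ⊨H φ)

-- specifications over a finite AP = Fin k, with a possibly enlarged AP (fresh propositions)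
Spec : Set
Spec = Σ ℕ λ k → LTL (Fin k) × Hyper (Fin k) 0

{-# OPTIONS --safe #-}
-- Add a fresh proposition, the marker, and let the payload of a trace be its suffix after the
-- last occurrence of the marker.  ψ′ demands that the marker occurs a last time and that ψ holds
-- afterwards; this is liveness, since any finite word can be continued by a last marker followed
-- by a model of ψ.  Likewise the body of φ′ demands that the markers of all quantified traces
-- occur for the last time at one common position, after which the payloads satisfy the body of φ.
-- A model T of (ψ, φ) gives the model {pad u | u ∈ T}, whose traces all carry their last marker at
-- position 0; a model of (ψ′, φ′) gives the set of payloads of its traces.  As a last occurrence is
-- unique, the common position demanded by φ′ is every trace's own cut point, so in both directions
-- the quantifiers transfer along the relation "is the payload of".
module Submission where

open import Defs
open import Data.Nat using (ℕ; zero; suc; _+_; _<_; z≤n; s≤s)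
open import Data.Nat.Properties using (+-identityʳ; <-cmp)
open import Data.Fin using (Fin; zero; suc)
open import Data.Product using (Σ; _×_; _,_; proj₁; proj₂; map₂)
open import Data.Bool using (true; false)
open import Data.Vec using (Vec; []; _∷_; _∷ʳ_; lookup)
open import Data.Vec.Relation.Binary.Pointwise.Inductive as Pointwise using (Pointwise; []; _∷_)
open import Data.List using ([]; _∷_)
open import Data.Unit using (tt)
open import Data.Empty using (⊥-elim)
open import Function using (_∘_; id)
open import Function.Bundles using (_⇔_; mk⇔; Equivalence)
open import Function.Construct.Composition using (_⇔-∘_)
open import Relation.Nullary using (¬_)
open import Relation.Binary.PropositionalEquality using (_≡_; refl; sym; trans; subst; cong)
open import Relation.Binary.Definitions using (tri<; tri≈; tri>)

open Equivalence using (to; from)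

private
  variable
    A B : Set

rename : (A → B) → LTL A → LTL B
rename f (atom a) = atom (f a)
rename f (¬' φ)   = ¬' (rename f φ)
rename f (φ ∧' χ) = rename f φ ∧' rename f χ
rename f (X' φ)   = X' (rename f φ)
rename f (φ U' χ) = rename f φ U' rename f χ

tail : Trace A → Trace A
tail t i = t (suc i)

drop : ℕ → Trace A → Trace A
drop n t i = t (n + i)

_∷ᵗ_ : Letter A → Trace A → Trace A
(x ∷ᵗ t) zero    = x
(x ∷ᵗ t) (suc i) = t i

⊨-tail : (t : Trace A) (φ : LTL A) (i : ℕ) → (t at suc i ⊨ φ) ⇔ (tail t at i ⊨ φ)
⊨-tail t (atom a) i = mk⇔ id id
⊨-tail t (¬' φ)   i = mk⇔ (λ ¬φ → ¬φ ∘ from (⊨-tail t φ i)) (λ ¬φ → ¬φ ∘ to (⊨-tail t φ i))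
⊨-tail t (φ ∧' χ) i =
  mk⇔ (λ (a , b) → to (⊨-tail t φ i) a , to (⊨-tail t χ i) b)
      (λ (a , b) → from (⊨-tail t φ i) a , from (⊨-tail t χ i) b)
⊨-tail t (X' φ)   i = ⊨-tail t φ (suc i)
⊨-tail t (φ U' χ) i = mk⇔
  (λ { (suc j , s≤s i≤j , χj , φ<j) → j , i≤j , to (⊨-tail t χ j) χj ,
         λ k i≤k k<j → to (⊨-tail t φ k) (φ<j (suc k) (s≤s i≤k) (s≤s k<j)) })
  (λ { (j , i≤j , χj , φ<j) → suc j , s≤s i≤j , from (⊨-tail t χ j) χj ,
         λ { (suc k) (s≤s i≤k) (s≤s k<j) → from (⊨-tail t φ k) (φ<j k i≤k k<j) } })

⊨-drop : (n : ℕ) (t : Trace A) (φ : LTL A) (i : ℕ) → (t at (n + i) ⊨ φ) ⇔ (drop n t at i ⊨ φ)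
⊨-drop zero    t φ i = mk⇔ id id
⊨-drop (suc n) t φ i = ⊨-drop n (tail t) φ i ⇔-∘ ⊨-tail t φ (n + i)

⊨-rename : (f : A → B) (t : Trace B) (u : Trace A) → (∀ i x → t i (f x) ≡ u i x) →
           (φ : LTL A) (i : ℕ) → (t at i ⊨ rename f φ) ⇔ (u at i ⊨ φ)
⊨-rename f t u t≗u (atom a) i = mk⇔ (trans (sym (t≗u i a))) (trans (t≗u i a))
⊨-rename f t u t≗u (¬' φ)   i =
  mk⇔ (λ ¬φ → ¬φ ∘ from (⊨-rename f t u t≗u φ i)) (λ ¬φ → ¬φ ∘ to (⊨-rename f t u t≗u φ i))
⊨-rename f t u t≗u (φ ∧' χ) i =
  mk⇔ (λ (a , b) → to (⊨-rename f t u t≗u φ i) a , to (⊨-rename f t u t≗u χ i) b)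
      (λ (a , b) → from (⊨-rename f t u t≗u φ i) a , from (⊨-rename f t u t≗u χ i) b)
⊨-rename f t u t≗u (X' φ)   i = ⊨-rename f t u t≗u φ (suc i)
⊨-rename f t u t≗u (φ U' χ) i = mk⇔
  (λ (j , i≤j , χj , φ<j) → j , i≤j , to (⊨-rename f t u t≗u χ j) χj ,
     λ k i≤k k<j → to (⊨-rename f t u t≗u φ k) (φ<j k i≤k k<j))
  (λ (j , i≤j , χj , φ<j) → j , i≤j , from (⊨-rename f t u t≗u χ j) χj ,
     λ k i≤k k<j → from (⊨-rename f t u t≗u φ k) (φ<j k i≤k k<j))

⊨-rename-drop : (f : A → B) (n : ℕ) (t : Trace B) (u : Trace A) →
                (∀ i x → t (n + i) (f x) ≡ u i x) →
                (φ : LTL A) → (t at n ⊨ rename f φ) ⇔ (u ⊨ φ)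
⊨-rename-drop f n t u t≗u φ =
  ⊨-rename f (drop n t) u t≗u φ 0
    ⇔-∘ subst (λ p → (t at p ⊨ rename f φ) ⇔ (drop n t ⊨ rename f φ))
              (+-identityʳ n) (⊨-drop n t (rename f φ) 0)

-- The syntax has no constant for truth; any atom yields one.
⊤′ : A → LTL A
⊤′ x = ¬' (atom x ∧' ¬' (atom x))

⊨-⊤′ : (t : Trace A) (i : ℕ) (x : A) → t at i ⊨ ⊤′ x
⊨-⊤′ t i x (x-holds , x-fails) = x-fails x-holds

◇ : A → LTL A → LTL A
◇ x θ = ⊤′ x U' θ

◇-liveness : (x : A) (θ : LTL A) → LTLSat (◇ x θ) → Liveness (◇ x θ)
◇-liveness x θ sat [] = proj₁ sat , tt , proj₂ sat
◇-liveness x θ sat (y ∷ w) with ◇-liveness x θ sat w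
... | t , w≺t , (j , _ , θj , _) =
  y ∷ᵗ t , ((λ _ → refl) , w≺t) ,
  suc j , z≤n , from (⊨-tail (y ∷ᵗ t) θ j) θj , λ k _ _ → ⊨-⊤′ (y ∷ᵗ t) k x

last : A → LTL A
last x = atom x ∧' X' (¬' (◇ x (atom x)))

LastAt : Trace A → A → ℕ → Set
LastAt t x p = t p x ≡ true × (∀ q → p < q → ¬ t q x ≡ true)

⊨-last : (t : Trace A) (x : A) (p : ℕ) → (t at p ⊨ last x) ⇔ LastAt t x p
⊨-last t x p = mk⇔
  (λ (holds , never) → holds , λ q p<q holds-q → never (q , p<q , holds-q , λ k _ _ → ⊨-⊤′ t k x))
  (λ (holds , never) → holds , λ (q , p<q , holds-q , _) → never q p<q holds-q)

LastAt-unique : {t : Trace A} {x : A} {p q : ℕ} → LastAt t x p → LastAt t x q → p ≡ q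
LastAt-unique {p = p} {q} (holds-p , never-p) (holds-q , never-q) with <-cmp p q
... | tri< p<q _ _ = ⊥-elim (never-p q p<q holds-q)
... | tri≈ _ p≡q _ = p≡q
... | tri> _ _ q<p = ⊥-elim (never-q p q<p holds-p)

⋀ : (v : ℕ) → (Fin (suc v) → LTL A) → LTL A
⋀ zero    f = f zero
⋀ (suc v) f = f zero ∧' ⋀ v (f ∘ suc)

⊨-⋀ : (t : Trace A) (i v : ℕ) (f : Fin (suc v) → LTL A) → (t at i ⊨ ⋀ v f) ⇔ (∀ j → t at i ⊨ f j)
⊨-⋀ t i zero    f = mk⇔ (λ { h zero → h }) (λ h → h zero)
⊨-⋀ t i (suc v) f = mk⇔
  (λ { (h , _) zero → h ; (_ , hs) (suc j) → to (⊨-⋀ t i v (f ∘ suc)) hs j })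
  (λ h → h zero , from (⊨-⋀ t i v (f ∘ suc)) (h ∘ suc))

encode : {v : ℕ} → (Fin (suc v) → B) → (A → B) → LTL A → LTL B
encode {v = v} mark f θ = ◇ (mark zero) (⋀ v (last ∘ mark) ∧' X' (rename f θ))

encode-intro : {v : ℕ} (mark : Fin (suc v) → B) (f : A → B) (θ : LTL A)
               (t : Trace B) (u : Trace A) (s : ℕ) →
               (∀ j → LastAt t (mark j) s) → (∀ i x → t (suc s + i) (f x) ≡ u i x) →
               u ⊨ θ → t ⊨ encode mark f θ
encode-intro {v = v} mark f θ t u s lasts t≗u u⊨θ =
  s , z≤n ,
  (from (⊨-⋀ t s v (last ∘ mark)) (λ j → from (⊨-last t (mark j) s) (lasts j)) ,
   from (⊨-rename-drop f (suc s) t u t≗u θ) u⊨θ) ,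
  λ k _ _ → ⊨-⊤′ t k (mark zero)

encode-elim : {v : ℕ} (mark : Fin (suc v) → B) (f : A → B) (θ : LTL A) (t : Trace B) →
              t ⊨ encode mark f θ →
              Σ ℕ λ s → (∀ j → LastAt t (mark j) s)
                      × (∀ u → (∀ i x → t (suc s + i) (f x) ≡ u i x) → u ⊨ θ)
encode-elim {v = v} mark f θ t (s , _ , (lasts , θs) , _) =
  s , (λ j → to (⊨-last t (mark j) s) (to (⊨-⋀ t s v (last ∘ mark)) lasts j)) ,
  λ u t≗u → to (⊨-rename-drop f (suc s) t u t≗u θ) θs

∷ʳ⁺ : {R : A → B → Set} {v : ℕ} {xs : Vec A v} {ys : Vec B v} {x : A} {y : B} →
      Pointwise R xs ys → R x y → Pointwise R (xs ∷ʳ x) (ys ∷ʳ y)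
∷ʳ⁺ []           Rxy = Rxy ∷ []
∷ʳ⁺ (Rx₀y₀ ∷ rel) Rxy = Rx₀y₀ ∷ ∷ʳ⁺ rel Rxy

module _ (tr : ∀ {v} → LTL (Fin v × A) → LTL (Fin v × B)) where

  mapBody : {v : ℕ} → Hyper A v → Hyper B v
  mapBody (∀' φ)   = ∀' (mapBody φ)
  mapBody (∃' φ)   = ∃' (mapBody φ)
  mapBody (body χ) = body (tr χ)

  mapBody-ExPrefix : {v : ℕ} (m : ℕ) (φ : Hyper A v) → ExPrefix m φ → ExPrefix m (mapBody φ)
  mapBody-ExPrefix zero    (body _) prefix = prefix
  mapBody-ExPrefix (suc m) (∃' φ)   prefix = mapBody-ExPrefix m φ prefix

  mapBody-AEPrefix : {v : ℕ} (n m : ℕ) (φ : Hyper A v) → AEPrefix n m φ → AEPrefix n m (mapBody φ)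
  mapBody-AEPrefix zero    m φ      prefix = mapBody-ExPrefix m φ prefix
  mapBody-AEPrefix (suc n) m (∀' φ) prefix = mapBody-AEPrefix n m φ prefix

  mapBody-matrix : (P : ∀ {v} → LTL (Fin v × A) → Set) (Q : ∀ {v} → LTL (Fin v × B) → Set) →
                   (∀ {v} (χ : LTL (Fin v × A)) → P χ → Q (tr χ)) →
                   {v : ℕ} (φ : Hyper A v) → P (proj₂ (matrix φ)) → Q (proj₂ (matrix (mapBody φ)))
  mapBody-matrix P Q P⇒Q (∀' φ)   = mapBody-matrix P Q P⇒Q φ
  mapBody-matrix P Q P⇒Q (∃' φ)   = mapBody-matrix P Q P⇒Q φ
  mapBody-matrix P Q P⇒Q (body χ) = P⇒Q χ

  module _ (R : Trace A → Trace B → Set) (TA : Trace A → Set) (TB : Trace B → Set)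
           (forth : ∀ u → TA u → Σ (Trace B) λ t → TB t × R u t)
           (back  : ∀ t → TB t → Σ (Trace A) λ u → TA u × R u t) where

    HSat-mapBody⁺ : (∀ {v} (χ : LTL (Fin v × A)) envA envB →
                       Pointwise R envA envB → zipT envA ⊨ χ → zipT envB ⊨ tr χ) →
                    {v : ℕ} (φ : Hyper A v) (envA : Vec (Trace A) v) (envB : Vec (Trace B) v) →
                    Pointwise R envA envB → HSat TA envA φ → HSat TB envB (mapBody φ)
    HSat-mapBody⁺ body⁺ (∀' φ) envA envB rel sat t t∈TB =
      let (u , u∈TA , Rut) = back t t∈TB in
      HSat-mapBody⁺ body⁺ φ (envA ∷ʳ u) (envB ∷ʳ t) (∷ʳ⁺ rel Rut) (sat u u∈TA)
    HSat-mapBody⁺ body⁺ (∃' φ) envA envB rel (u , u∈TA , sat) =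
      let (t , t∈TB , Rut) = forth u u∈TA in
      t , t∈TB , HSat-mapBody⁺ body⁺ φ (envA ∷ʳ u) (envB ∷ʳ t) (∷ʳ⁺ rel Rut) sat
    HSat-mapBody⁺ body⁺ (body χ) envA envB rel sat = body⁺ χ envA envB rel sat

    HSat-mapBody⁻ : (∀ {v} (χ : LTL (Fin v × A)) envA envB →
                       Pointwise R envA envB → zipT envB ⊨ tr χ → zipT envA ⊨ χ) →
                    {v : ℕ} (φ : Hyper A v) (envA : Vec (Trace A) v) (envB : Vec (Trace B) v) →
                    Pointwise R envA envB → HSat TB envB (mapBody φ) → HSat TA envA φ
    HSat-mapBody⁻ body⁻ (∀' φ) envA envB rel sat u u∈TA =
      let (t , t∈TB , Rut) = forth u u∈TA in
      HSat-mapBody⁻ body⁻ φ (envA ∷ʳ u) (envB ∷ʳ t) (∷ʳ⁺ rel Rut) (sat t t∈TB)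
    HSat-mapBody⁻ body⁻ (∃' φ) envA envB rel (t , t∈TB , sat) =
      let (u , u∈TA , Rut) = back t t∈TB in
      u , u∈TA , HSat-mapBody⁻ body⁻ φ (envA ∷ʳ u) (envB ∷ʳ t) (∷ʳ⁺ rel Rut) sat
    HSat-mapBody⁻ body⁻ (body χ) envA envB rel sat = body⁻ χ envA envB rel sat

no-LTL-over-Fin0 : ¬ LTL (Fin 0 × A)
no-LTL-over-Fin0 (atom (() , _))
no-LTL-over-Fin0 (¬' φ)   = no-LTL-over-Fin0 φ
no-LTL-over-Fin0 (φ ∧' _) = no-LTL-over-Fin0 φ
no-LTL-over-Fin0 (X' φ)   = no-LTL-over-Fin0 φ
no-LTL-over-Fin0 (φ U' _) = no-LTL-over-Fin0 φ

module _ {k : ℕ} where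

  pad : Trace (Fin k) → Trace (Fin (suc k))
  pad u zero    _       = true
  pad u (suc i) zero    = false
  pad u (suc i) (suc a) = u i a

  pad-last : (u : Trace (Fin k)) → LastAt (pad u) zero 0
  pad-last u = refl , λ { (suc q) _ () }

  unpad : ℕ → Trace (Fin (suc k)) → Trace (Fin k)
  unpad s t i a = t (suc s + i) (suc a)

  Payload : Trace (Fin k) → Trace (Fin (suc k)) → Set
  Payload u t = Σ ℕ λ s → LastAt t zero s × u ≡ unpad s t

  Payload-unpad : {u : Trace (Fin k)} {t : Trace (Fin (suc k))} {s : ℕ} →
                  Payload u t → LastAt t zero s → u ≡ unpad s t
  Payload-unpad {t = t} (p , last-p , refl) last-s rewrite LastAt-unique {t = t} last-p last-s = refl

  ψ′ : LTL (Fin k) → LTL (Fin (suc k))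
  ψ′ = encode {v = 0} (λ _ → zero) suc

  pad-⊨-ψ′ : (ψ : LTL (Fin k)) (u : Trace (Fin k)) → u ⊨ ψ → pad u ⊨ ψ′ ψ
  pad-⊨-ψ′ ψ u =
    encode-intro {v = 0} (λ _ → zero) suc ψ (pad u) u 0 (λ _ → pad-last u) (λ _ _ → refl)

  ψ′-payload : (ψ : LTL (Fin k)) (t : Trace (Fin (suc k))) →
               t ⊨ ψ′ ψ → Σ (Trace (Fin k)) λ u → Payload u t
  ψ′-payload ψ t t⊨ψ′ =
    let (s , lasts , _) = encode-elim {v = 0} (λ _ → zero) suc ψ t t⊨ψ′
    in unpad s t , s , lasts zero , refl

  ψ′-liveness : (ψ : LTL (Fin k)) → LTLSat ψ → Liveness (ψ′ ψ)
  ψ′-liveness ψ (u , u⊨ψ) =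
    ◇-liveness zero (last zero ∧' X' (rename suc ψ)) (pad u , pad-⊨-ψ′ ψ u u⊨ψ)

  Payload-⊨ : (ψ : LTL (Fin k)) (u : Trace (Fin k)) (t : Trace (Fin (suc k))) →
              t ⊨ ψ′ ψ → Payload u t → u ⊨ ψ
  Payload-⊨ ψ u t t⊨ψ′ payload =
    let (s , lasts , payload-⊨) = encode-elim {v = 0} (λ _ → zero) suc ψ t t⊨ψ′
        u≡unpad = Payload-unpad {t = t} payload (lasts zero)
    in payload-⊨ u (λ i a → sym (cong (λ u → u i a) u≡unpad))

  bodyT : {v : ℕ} → LTL (Fin v × Fin k) → LTL (Fin v × Fin (suc k))
  bodyT {zero}  χ = ⊥-elim (no-LTL-over-Fin0 χ)
  bodyT {suc v} χ = encode (_, zero) (map₂ suc) χ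

  bodyT-liveness : {v : ℕ} (χ : LTL (Fin v × Fin k)) → LTLSat χ → Liveness (bodyT χ)
  bodyT-liveness {zero}  χ _        = ⊥-elim (no-LTL-over-Fin0 χ)
  bodyT-liveness {suc v} χ (Y , Y⊨χ) =
    ◇-liveness _ (⋀ v (last ∘ (_, zero)) ∧' X' (rename (map₂ suc) χ))
      (padded , encode-intro _ _ χ padded Y 0 (λ j → pad-last (column j)) (λ _ _ → refl) Y⊨χ)
    where
    column : Fin (suc v) → Trace (Fin k)
    column j i a = Y i (j , a)
    padded : Trace (Fin (suc v) × Fin (suc k))
    padded i (j , a) = pad (column j) i a

  bodyT-pad : {v : ℕ} (χ : LTL (Fin v × Fin k))
              (envA : Vec (Trace (Fin k)) v) (envB : Vec (Trace (Fin (suc k))) v) →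
              Pointwise (λ u t → t ≡ pad u) envA envB → zipT envA ⊨ χ → zipT envB ⊨ bodyT χ
  bodyT-pad {zero}  χ _ _ _ = ⊥-elim (no-LTL-over-Fin0 χ)
  bodyT-pad {suc v} χ envA envB padded = encode-intro _ _ χ (zipT envB) (zipT envA) 0 lasts agree
    where
    lasts : ∀ j → LastAt (zipT envB) (j , zero) 0
    lasts j = subst (λ t → LastAt t zero 0) (sym (Pointwise.lookup padded j)) (pad-last (lookup envA j))
    agree : ∀ i x → zipT envB (suc i) (map₂ suc x) ≡ zipT envA i x
    agree i (j , a) = cong (λ t → t (suc i) (suc a)) (Pointwise.lookup padded j)

  bodyT-unpad : {v : ℕ} (χ : LTL (Fin v × Fin k))
                (envA : Vec (Trace (Fin k)) v) (envB : Vec (Trace (Fin (suc k))) v) →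
                Pointwise Payload envA envB → zipT envB ⊨ bodyT χ → zipT envA ⊨ χ
  bodyT-unpad {zero}  χ _ _ _ = ⊥-elim (no-LTL-over-Fin0 χ)
  bodyT-unpad {suc v} χ envA envB payloads envB⊨χ′ =
    let (s , lasts , payload-⊨) = encode-elim _ _ χ (zipT envB) envB⊨χ′
    in payload-⊨ (zipT envA) λ i (j , a) →
         sym (cong (λ u → u i a) (Payload-unpad {t = lookup envB j} (Pointwise.lookup payloads j) (lasts j)))

  SpecSat-pad : {ψ : LTL (Fin k)} {φ : Hyper (Fin k) 0} → SpecSat ψ φ → SpecSat (ψ′ ψ) (mapBody bodyT φ)
  SpecSat-pad {ψ} {φ} (T , (u , u∈T) , T⊨ψ , T⊨φ) =
    Padded , (pad u , u , u∈T , refl) , (λ { _ (u , u∈T , refl) → pad-⊨-ψ′ ψ u (T⊨ψ u u∈T) }) ,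
    HSat-mapBody⁺ bodyT (λ u t → t ≡ pad u) T Padded
      (λ u u∈T → pad u , (u , u∈T , refl) , refl) (λ _ t∈Padded → t∈Padded)
      bodyT-pad φ [] [] [] T⊨φ
    where
    Padded : Trace (Fin (suc k)) → Set
    Padded t = Σ (Trace (Fin k)) λ u → T u × t ≡ pad u

  SpecSat-unpad : {ψ : LTL (Fin k)} {φ : Hyper (Fin k) 0} → SpecSat (ψ′ ψ) (mapBody bodyT φ) → SpecSat ψ φ
  SpecSat-unpad {ψ} {φ} (T′ , (t , t∈T′) , T′⊨ψ′ , T′⊨φ′) =
    Payloads , nonempty ,
    (λ { u (t , t∈T′ , payload) → Payload-⊨ ψ u t (T′⊨ψ′ t t∈T′) payload }) ,
    HSat-mapBody⁻ bodyT Payload Payloads T′ (λ _ u∈Payloads → u∈Payloads) back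
      bodyT-unpad φ [] [] [] T′⊨φ′
    where
    Payloads : Trace (Fin k) → Set
    Payloads u = Σ (Trace (Fin (suc k))) λ t → T′ t × Payload u t
    back : ∀ t → T′ t → Σ (Trace (Fin k)) λ u → Payloads u × Payload u t
    back t t∈T′ = let (u , payload) = ψ′-payload ψ t (T′⊨ψ′ t t∈T′) in u , (t , t∈T′ , payload) , payload
    nonempty : Σ (Trace (Fin k)) Payloads
    nonempty = let (u , u∈Payloads , _) = back t t∈T′ in u , u∈Payloads

theorem4p3 : Σ ((k : ℕ) → LTL (Fin k) → Hyper (Fin k) 0 → Spec) λ F →
    (k n m : ℕ) (ψ : LTL (Fin k)) (φ : Hyper (Fin k) 0) →
    AEPrefix n m φ → LTLSat ψ → LTLSat (proj₂ (matrix φ)) →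
    Liveness (proj₁ (proj₂ (F k ψ φ)))
    × AEPrefix n m (proj₂ (proj₂ (F k ψ φ)))
    × TemporalLiveness (proj₂ (proj₂ (F k ψ φ)))
    × (SpecSat ψ φ ⇔ SpecSat (proj₁ (proj₂ (F k ψ φ))) (proj₂ (proj₂ (F k ψ φ))))
theorem4p3 = (λ k ψ φ → suc k , ψ′ ψ , mapBody bodyT φ) , λ k n m ψ φ prefix ψ-sat matrix-sat →
  ψ′-liveness ψ ψ-sat ,
  mapBody-AEPrefix bodyT n m φ prefix ,
  mapBody-matrix bodyT LTLSat Liveness bodyT-liveness φ matrix-sat ,
  mk⇔ (SpecSat-pad {ψ = ψ} {φ}) (SpecSat-unpad {ψ = ψ} {φ})
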